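{- Let $n,q$ be positive integers with $q\ge 2$. Then $b(H_{n,q}^{n-1})\ge q^{n-1}$.
   Context: For $q\ge 2$, the Hamming graph $H_{n,q}$ has vertex set $\mathbb{Z}_q^n$, two $n$-tuples being adjacent iff they differ in exactly one coordinate; its graph distance between two tuples is the number of coordinates in which they differ. The $p$-th power $G^p$ of a graph $G$ has vertex set $V(G)$, with distinct $x,y$ adjacent iff $d_G(x,y)\le p$. A b-coloring of a graph $G$ with $k$ colors is a proper vertex coloring with $k$ colors in which every color class contains a vertex adjacent to at least one vertex of every other color class; the b-chromatic number $b(G)$ is the largest $k$ for which $G$ has a b-coloring with $k$ colors. -}

module Defs where

open import Data.Nat using (ℕ; zero; suc; _≤_; _+_)
open import Data.Fin using (Fin)
open import Data.Vec using (Vec; []; _∷_)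
open import Data.Product using (Σ; ∃; ∃-syntax; _×_; _,_)
open import Relation.Binary.PropositionalEquality using (_≡_)
open import Relation.Nullary using (¬_; yes; no)
open import Data.Fin using (_≟_)

hamming : ∀ {q n} → Vec (Fin q) n → Vec (Fin q) n → ℕ
hamming [] [] = 0
hamming (x ∷ xs) (y ∷ ys) with x ≟ y
... | yes _ = hamming xs ys
... | no  _ = suc (hamming xs ys)

record Graph : Set₁ where
  field
    V   : Set
    Adj : V → V → Set

open Graph public

HammingGraph : ℕ → ℕ → Graph
HammingGraph n q = record { V = Vec (Fin q) n ; Adj = λ x y → hamming x y ≡ 1 }

-- The p-th power of the Hamming graph: distinct x, y adjacent iff
-- d(x,y) ≤ p, where d is the graph distance of H_{n,q} (= Hamming distance).
HammingPower : ℕ → ℕ → ℕ → Graph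
HammingPower n q p = record
  { V = Vec (Fin q) n
  ; Adj = λ x y → ¬ (x ≡ y) × (hamming x y ≤ p) }

record IsBColoring (G : Graph) (k : ℕ) (c : V G → Fin k) : Set where
  field
    proper : ∀ x y → Adj G x y → ¬ (c x ≡ c y)
    bVertex : ∀ (i : Fin k) → ∃[ x ] (c x ≡ i × (∀ (j : Fin k) → ¬ (j ≡ i) → ∃[ y ] (Adj G x y × c y ≡ j)))

HasBColoring : Graph → ℕ → Set
HasBColoring G k = ∃[ c ] IsBColoring G k c

-- b(G) ≥ m : G has a b-coloring with some number k ≥ m of colors.
-- (b(G) is the maximum such k; for finite G this is equivalent.)
bChromatic≥ : Graph → ℕ → Set
bChromatic≥ G m = ∃[ k ] (m ≤ k × HasBColoring G k)

-- Color a tuple (x₀, x₁, …, x_m) of ℤ_q^(m+1) by its offsets (x₁ + x₀, …, x_m + x₀) ∈ ℤ_q^m.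
-- Two tuples at distance ≤ m agree in some coordinate; if they also have the same
-- offsets, cancellation in ℤ_q first forces x₀ = y₀ and then xᵢ = yᵢ, so the coloring
-- is proper in the m-th power of H_{m+1,q}. The tuples (0, v) realise every color and
-- pairwise differ at most in their last m coordinates, so each is a b-vertex.
module Submission where

open import Defs
open import Data.Nat using (ℕ; zero; suc; _≤_; _<_; _^_; _∸_; _+_; z≤n; s≤s; s≤s⁻¹)
open import Data.Nat.Properties using (≤-refl; m≤n⇒m≤1+n; +-assoc; +-comm; +-identityʳ; m∸n+n≡m)
open import Data.Nat.DivMod using (_%_; _mod_; %-distribˡ-+; m%n%n≡m%n; [m+n]%n≡m%n; m<n⇒m%n≡m)
open import Data.Fin using (Fin; zero; suc; toℕ; funToFin; finToFun; combine; _≟_)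
open import Data.Fin.Properties using (toℕ-injective; toℕ-fromℕ<; toℕ<n; toℕ≤n; finToFun-funToFin; funToFin-finToFin)
open import Data.Vec using (Vec; []; _∷_; lookup; tabulate)
open import Data.Vec.Properties using (tabulate∘lookup; tabulate-cong; lookup∘tabulate)
open import Data.Product using (∃-syntax; _×_; _,_)
open import Relation.Nullary using (¬_; yes; no; contradiction)
open import Relation.Binary.PropositionalEquality
  using (_≡_; _≗_; refl; sym; trans; cong; cong₂; subst; module ≡-Reasoning)

module ModularAddition {n : ℕ} where

  infixl 6 _⊕_

  _⊕_ : Fin (suc n) → Fin (suc n) → Fin (suc n)
  a ⊕ b = (toℕ a + toℕ b) mod suc n

  toℕ-⊕ : ∀ a b → toℕ (a ⊕ b) ≡ (toℕ a + toℕ b) % suc n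
  toℕ-⊕ a b = toℕ-fromℕ< _

  ⊕-comm : ∀ a b → a ⊕ b ≡ b ⊕ a
  ⊕-comm a b = cong (_mod suc n) (+-comm (toℕ a) (toℕ b))

  ⊕-identityʳ : ∀ a → a ⊕ zero ≡ a
  ⊕-identityʳ a = toℕ-injective (begin
    toℕ (a ⊕ zero)        ≡⟨ toℕ-⊕ a zero ⟩
    (toℕ a + 0) % suc n   ≡⟨ cong (_% suc n) (+-identityʳ (toℕ a)) ⟩
    toℕ a % suc n         ≡⟨ m<n⇒m%n≡m (toℕ<n a) ⟩
    toℕ a                 ∎)
    where open ≡-Reasoning

  ⊕-retract : ∀ a b → (suc n ∸ toℕ a + toℕ (a ⊕ b)) % suc n ≡ toℕ b
  ⊕-retract a b = begin
    (k + toℕ (a ⊕ b)) % q         ≡⟨ cong (λ t → (k + t) % q) (toℕ-⊕ a b) ⟩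
    (k + (A + B) % q) % q         ≡⟨ %-distribˡ-+ k ((A + B) % q) q ⟩
    (k % q + (A + B) % q % q) % q ≡⟨ cong (λ t → (k % q + t) % q) (m%n%n≡m%n (A + B) q) ⟩
    (k % q + (A + B) % q) % q     ≡⟨ %-distribˡ-+ k (A + B) q ⟨
    (k + (A + B)) % q             ≡⟨ cong (_% q) (+-assoc k A B) ⟨
    (k + A + B) % q               ≡⟨ cong (λ t → (t + B) % q) (m∸n+n≡m (toℕ≤n a)) ⟩
    (q + B) % q                   ≡⟨ cong (_% q) (+-comm q B) ⟩
    (B + q) % q                   ≡⟨ [m+n]%n≡m%n B q ⟩
    B % q                         ≡⟨ m<n⇒m%n≡m (toℕ<n b) ⟩
    B                             ∎
    where
    open ≡-Reasoning
    q = suc n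
    A = toℕ a
    B = toℕ b
    k = q ∸ A

  ⊕-cancelˡ : ∀ a {b c} → a ⊕ b ≡ a ⊕ c → b ≡ c
  ⊕-cancelˡ a {b} {c} eq = toℕ-injective (begin
    toℕ b                                  ≡⟨ ⊕-retract a b ⟨
    (suc n ∸ toℕ a + toℕ (a ⊕ b)) % suc n  ≡⟨ cong (λ t → (suc n ∸ toℕ a + toℕ t) % suc n) eq ⟩
    (suc n ∸ toℕ a + toℕ (a ⊕ c)) % suc n  ≡⟨ ⊕-retract a c ⟩
    toℕ c                                  ∎)
    where open ≡-Reasoning

  ⊕-cancelʳ : ∀ {b c} a → b ⊕ a ≡ c ⊕ a → b ≡ c
  ⊕-cancelʳ {b} {c} a eq = ⊕-cancelˡ a (trans (⊕-comm a b) (trans eq (⊕-comm c a)))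

open ModularAddition

hamming-∷ : ∀ {q n} (a : Fin q) (xs ys : Vec (Fin q) n) → hamming (a ∷ xs) (a ∷ ys) ≡ hamming xs ys
hamming-∷ a xs ys with a ≟ a
... | yes _  = refl
... | no a≢a = contradiction refl a≢a

hamming≤length : ∀ {q n} (xs ys : Vec (Fin q) n) → hamming xs ys ≤ n
hamming≤length [] [] = z≤n
hamming≤length (x ∷ xs) (y ∷ ys) with x ≟ y
... | yes _ = m≤n⇒m≤1+n (hamming≤length xs ys)
... | no _  = s≤s (hamming≤length xs ys)

hamming<length⇒agree : ∀ {q n} (xs ys : Vec (Fin q) n) → hamming xs ys < n →
                       ∃[ i ] lookup xs i ≡ lookup ys i
hamming<length⇒agree (x ∷ xs) (y ∷ ys) h with x ≟ y
... | yes x≡y = zero , x≡y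
... | no _ with hamming<length⇒agree xs ys (s≤s⁻¹ h)
...   | i , xsᵢ≡ysᵢ = suc i , xsᵢ≡ysᵢ

lookup-injective : ∀ {A : Set} {n} (xs ys : Vec A n) → lookup xs ≗ lookup ys → xs ≡ ys
lookup-injective xs ys eq = trans (sym (tabulate∘lookup xs)) (trans (tabulate-cong eq) (tabulate∘lookup ys))

funToFin-cong : ∀ {m q} {f g : Fin m → Fin q} → f ≗ g → funToFin f ≡ funToFin g
funToFin-cong {zero}  eq = refl
funToFin-cong {suc m} eq = cong₂ combine (eq zero) (funToFin-cong (λ i → eq (suc i)))

module HammingPowerColoring {m r : ℕ} where

  Tuple : Set
  Tuple = Vec (Fin (suc r)) (suc m)

  offsets : Tuple → Fin m → Fin (suc r)
  offsets (x₀ ∷ xs) i = lookup xs i ⊕ x₀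

  color : Tuple → Fin (suc r ^ m)
  color x = funToFin (offsets x)

  color-offsets : ∀ x y → color x ≡ color y → offsets x ≗ offsets y
  color-offsets x y eq i = begin
    offsets x i                   ≡⟨ finToFun-funToFin (offsets x) i ⟨
    finToFun (color x) i         ≡⟨ cong (λ c → finToFun c i) eq ⟩
    finToFun (color y) i         ≡⟨ finToFun-funToFin (offsets y) i ⟩
    offsets y i                   ∎
    where open ≡-Reasoning

  offsets-agree⇒≡ : ∀ x y → offsets x ≗ offsets y → ∃[ i ] lookup x i ≡ lookup y i → x ≡ y
  offsets-agree⇒≡ (x₀ ∷ xs) (y₀ ∷ ys) same (i , agree) = cong₂ _∷_ x₀≡y₀ xs≡ys
    where
    heads : ∀ k → lookup (x₀ ∷ xs) k ≡ lookup (y₀ ∷ ys) k → x₀ ≡ y₀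
    heads zero    x₀≡y₀ = x₀≡y₀
    heads (suc j) xⱼ≡yⱼ = ⊕-cancelˡ (lookup ys j) (trans (cong (_⊕ x₀) (sym xⱼ≡yⱼ)) (same j))

    x₀≡y₀ : x₀ ≡ y₀
    x₀≡y₀ = heads i agree

    xs≡ys : xs ≡ ys
    xs≡ys = lookup-injective xs ys (λ j → ⊕-cancelʳ y₀ (trans (cong (lookup xs j ⊕_) (sym x₀≡y₀)) (same j)))

  color-proper : ∀ x y → Adj (HammingPower (suc m) (suc r) m) x y → ¬ color x ≡ color y
  color-proper x y (x≢y , close) same =
    x≢y (offsets-agree⇒≡ x y (color-offsets x y same) (hamming<length⇒agree x y (s≤s close)))

  digits : Fin (suc r ^ m) → Fin m → Fin (suc r)
  digits = finToFun {suc r} {m}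

  representative : Fin (suc r ^ m) → Tuple
  representative c = zero ∷ tabulate (digits c)

  color-representative : ∀ c → color (representative c) ≡ c
  color-representative c = trans (funToFin-cong offsets≗) (funToFin-finToFin {m} c)
    where
    offsets≗ : offsets (representative c) ≗ digits c
    offsets≗ i = trans (⊕-identityʳ _) (lookup∘tabulate (digits c) i)

  representatives-adjacent : ∀ c d → ¬ c ≡ d →
    Adj (HammingPower (suc m) (suc r) m) (representative c) (representative d)
  representatives-adjacent c d c≢d =
    (λ eq → c≢d (trans (sym (color-representative c)) (trans (cong color eq) (color-representative d))))
    , subst (_≤ m) (sym (hamming-∷ zero (tabulate (digits c)) (tabulate (digits d))))
            (hamming≤length (tabulate (digits c)) (tabulate (digits d)))

  color-isBColoring : IsBColoring (HammingPower (suc m) (suc r) m) (suc r ^ m) color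
  color-isBColoring = record
    { proper  = color-proper
    ; bVertex = λ c → representative c , color-representative c
                    , λ d d≢c → representative d
                              , representatives-adjacent c d (λ c≡d → d≢c (sym c≡d))
                              , color-representative d
    }

open HammingPowerColoring

corollary5p2 : (n q : ℕ) → 1 ≤ n → 2 ≤ q →
    bChromatic≥ (HammingPower n q (n ∸ 1)) (q ^ (n ∸ 1))
-- The bound q ≥ 2 only serves to exclude q = 0.
corollary5p2 zero    _       ()  _
corollary5p2 _       zero    _   ()
corollary5p2 (suc m) (suc r) _   _ = suc r ^ m , ≤-refl , color , color-isBColoring
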